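{- Let $q\geq 2$ and $\gamma$ be integers such that Condition 1 holds for $q$ and $\gamma$. Then there is a completely regular code in $H(3,q)$ with covering radius $1$, eigenvalue $\lambda_2(3,q)$ and parameter $\gamma$.
   Context: Let $\mathcal{A}$ be a set of size $q$; $H(3,q)$ has vertex set $\mathcal{A}^3$, tuples adjacent iff they differ in exactly one position; $\lambda_2(3,q)=q-3$. A set $C$ of vertices is a completely regular code with covering radius $1$ if $C$ is a nonempty proper subset and there are integers $\beta,\gamma\geq1$ such that every vertex of $C$ has exactly $\beta$ neighbours outside $C$ and every vertex outside $C$ has exactly $\gamma$ neighbours in $C$; it has eigenvalue $\lambda_2(3,q)$ iff $3(q-1)-(\beta+\gamma)=q-3$, i.e. $\beta+\gamma=2q$. Condition 1 (for $q$ and $\gamma$): there exist integers $r,s,t$ with $0<r,s,t<q$ and integers $a,b,c$ with $0<c\leq\min\{q-s,q-t\}$, $0<b\leq \min\{t,q-r\}$, $0<a\leq\min\{r,s\}$ such that $cr=a(q-t)$, $b(q-s)=c(q-r)$, $at=bs$, and $\gamma=a+b+c$. -}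

module Defs where

open import Data.Nat using (ℕ; zero; suc; _+_; _*_; _∸_; _≤_; _<_)
open import Data.Nat.Base using (_⊓_)
open import Data.Bool using (Bool; true; false; if_then_else_; not)
open import Data.Fin using (Fin)
open import Data.Fin.Properties using (_≟_)
open import Data.List using (List; allFin; map; concatMap)
open import Data.Nat.ListAction using (sum)
open import Data.Product using (_×_; _,_; Σ; ∃; ∃-syntax)
open import Data.Integer as ℤ using (ℤ; +_)
open import Relation.Nullary.Decidable using (⌊_⌋)
open import Relation.Binary.PropositionalEquality using (_≡_)

Vertex : ℕ → Set
Vertex q = Fin q × Fin q × Fin q

diff : ∀ {q} → Fin q → Fin q → ℕ
diff x y = if ⌊ x ≟ y ⌋ then 0 else 1

dist : ∀ {q} → Vertex q → Vertex q → ℕ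
dist (x₁ , x₂ , x₃) (y₁ , y₂ , y₃) = diff x₁ y₁ + diff x₂ y₂ + diff x₃ y₃

Adjacent : ∀ {q} → Vertex q → Vertex q → Set
Adjacent u v = dist u v ≡ 1

adjacent? : ∀ {q} → Vertex q → Vertex q → Bool
adjacent? u v = ⌊ dist u v Data.Nat.≟ 1 ⌋
  where import Data.Nat

allVertices : (q : ℕ) → List (Vertex q)
allVertices q =
  concatMap (λ x → concatMap (λ y → map (λ z → (x , y , z)) (allFin q)) (allFin q)) (allFin q)

count : ∀ {q} → (Vertex q → Bool) → ℕ
count {q} P = sum (map (λ v → if P v then 1 else 0) (allVertices q))

Code : ℕ → Set
Code q = Vertex q → Bool

nbrsOutside : ∀ {q} → Code q → Vertex q → ℕ
nbrsOutside C v = count (λ w → adjacent? v w Data.Bool.∧ not (C w))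
  where import Data.Bool

nbrsInside : ∀ {q} → Code q → Vertex q → ℕ
nbrsInside C v = count (λ w → adjacent? v w Data.Bool.∧ C w)
  where import Data.Bool

record CRC1 (q : ℕ) (C : Code q) (β γ : ℕ) : Set where
  field
    nonempty   : ∃[ v ] C v ≡ true
    proper     : ∃[ v ] C v ≡ false
    β-pos      : 1 ≤ β
    γ-pos      : 1 ≤ γ
    inside     : ∀ v → C v ≡ true → nbrsOutside C v ≡ β
    outside    : ∀ v → C v ≡ false → nbrsInside C v ≡ γ

λ₂ : ℕ → ℤ
λ₂ q = + q ℤ.- + 3

crcEigenvalue : ℕ → ℕ → ℕ → ℤ
crcEigenvalue q β γ = + (3 * (q ∸ 1)) ℤ.- + (β + γ)

Condition1 : ℕ → ℕ → Set
Condition1 q γ =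
  Σ ℕ λ r → Σ ℕ λ s → Σ ℕ λ t → Σ ℕ λ a → Σ ℕ λ b → Σ ℕ λ c →
    (0 < r × r < q) × (0 < s × s < q) × (0 < t × t < q) ×
    (0 < c × c ≤ (q ∸ s) ⊓ (q ∸ t)) ×
    (0 < b × b ≤ t ⊓ (q ∸ r)) ×
    (0 < a × a ≤ r ⊓ s) ×
    (c * r ≡ a * (q ∸ t)) × (b * (q ∸ s) ≡ c * (q ∸ r)) × (a * t ≡ b * s) ×
    (γ ≡ a + b + c)

-- The code is the support of χ(x,y,z) = P(x,y) + W(x,z) + Q(y,z), where P, W, Q are 0/1 matrices
-- placed in blocks cut at x = r, y = q − t, z = q − s, with constant row and column sums (c,a), (c,b)
-- and (a,b) respectively; cyclic matrices provide them, the three equations of Condition 1 being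
-- exactly the double-counting identities they require. The blocks make the supports disjoint, so χ
-- is an indicator, and summing χ along the three lines through a vertex v gives a + b + c + q χ(v).
-- The lines through v contain v three times and every neighbour of v once, so a vertex outside the
-- code has γ = a + b + c neighbours in it, and a vertex inside has γ + q − 3 neighbours in it, i.e.
-- 2q − γ outside. Thus β + γ = 2q, which is the eigenvalue q − 3.

module Submission where

open import Defs
open import Data.Nat using (ℕ; _≤_)
open import Data.Product using (Σ; _×_; ∃-syntax)
open import Relation.Binary.PropositionalEquality using (_≡_)

open import Data.Bool using (Bool; true; false; if_then_else_; T; not; _∧_)
open import Data.Bool.Properties using (T-≡; ¬-not)
open import Data.Fin using (Fin; zero; suc; toℕ; fromℕ<)
open import Data.Fin.Properties using (toℕ<n; toℕ-fromℕ<; _≟_)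
import Data.Integer as ℤ
import Data.Integer.Properties as ℤ
open import Data.List using (List; []; _∷_; map; tabulate; concatMap; allFin; _++_)
open import Data.List.Properties using (map-++; map-∘)
open import Data.Nat hiding (_≟_)
open import Data.Nat.DivMod using (_%_; m<n⇒m%n≡m; [m+n]%n≡m%n; m%n<n)
open import Data.Nat.ListAction using () renaming (sum to listSum)
open import Data.Nat.ListAction.Properties using () renaming (sum-++ to listSum-++)
open import Data.Nat.Properties hiding (_≟_)
open import Data.Nat.Tactic.RingSolver using (solve-∀)
open import Data.Product using (_,_)
open import Function using (_∘_; id)
open import Function.Bundles using (Equivalence)
open import Relation.Binary.PropositionalEquality
open import Relation.Nullary.Decidable using (does; yes; no)
open ≡-Reasoning

open import Algebra.Properties.Semiring.Sum +-*-semiring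
  using (sum-syntax; sum-cong-≗; sum-replicate-zero; ∑-distrib-+; ∑-comm; *-distribˡ-sum)

𝟙 : Bool → ℕ
𝟙 b = if b then 1 else 0

when unless : Bool → ℕ → ℕ
when b u = if b then u else 0
unless b u = if b then 0 else u

when-0 : ∀ e → when e 0 ≡ 0
when-0 true  = refl
when-0 false = refl

when+unless : ∀ e u → when e u + unless e u ≡ u
when+unless true  u = +-identityʳ u
when+unless false u = refl

<⇒<ᵇ≡true : ∀ {m n} → m < n → (m <ᵇ n) ≡ true
<⇒<ᵇ≡true = Equivalence.to T-≡ ∘ <⇒<ᵇ

<ᵇ≡true⇒< : ∀ {m n} → (m <ᵇ n) ≡ true → m < n
<ᵇ≡true⇒< {m} {n} = <ᵇ⇒< m n ∘ Equivalence.from T-≡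

≤⇒<ᵇ≡false : ∀ {m n} → n ≤ m → (m <ᵇ n) ≡ false
≤⇒<ᵇ≡false n≤m = ¬-not (≤⇒≯ n≤m ∘ <ᵇ≡true⇒<)

<ᵇ≡false⇒≥ : ∀ {m n} → (m <ᵇ n) ≡ false → n ≤ m
<ᵇ≡false⇒≥ m≮ᵇn = ≮⇒≥ (λ m<n → subst T m≮ᵇn (<⇒<ᵇ m<n))

sumBelow : ℕ → (ℕ → ℕ) → ℕ
sumBelow n f = ∑[ i < n ] f (toℕ i)

sumBelow-cong : ∀ n {f g : ℕ → ℕ} → (∀ k → k < n → f k ≡ g k) → sumBelow n f ≡ sumBelow n g
sumBelow-cong n f≗g = sum-cong-≗ (λ i → f≗g (toℕ i) (toℕ<n i))

sumBelow-const : ∀ n c → sumBelow n (λ _ → c) ≡ n * c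
sumBelow-const zero    c = refl
sumBelow-const (suc n) c = cong (c +_) (sumBelow-const n c)

sumBelow-zero : ∀ n {f : ℕ → ℕ} → (∀ k → k < n → f k ≡ 0) → sumBelow n f ≡ 0
sumBelow-zero n f≗0 = trans (sumBelow-cong n f≗0) (trans (sumBelow-const n 0) (*-zeroʳ n))

sumBelow-+ : ∀ n (f g : ℕ → ℕ) → sumBelow n (λ k → f k + g k) ≡ sumBelow n f + sumBelow n g
sumBelow-+ n f g = ∑-distrib-+ {n} (f ∘ toℕ) (g ∘ toℕ)

sumBelow-comm : ∀ m n (f : ℕ → ℕ → ℕ) →
  sumBelow m (λ i → sumBelow n (f i)) ≡ sumBelow n (λ j → sumBelow m (λ i → f i j))
sumBelow-comm m n f = ∑-comm {m} {n} (λ i j → f (toℕ i) (toℕ j))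

sumBelow-++ : ∀ m n (f : ℕ → ℕ) → sumBelow (m + n) f ≡ sumBelow m f + sumBelow n (λ k → f (m + k))
sumBelow-++ zero    n f = refl
sumBelow-++ (suc m) n f = trans (cong (f 0 +_) (sumBelow-++ m n (f ∘ suc))) (sym (+-assoc (f 0) _ _))

sumBelow-split : ∀ {m n} (f : ℕ → ℕ) → m ≤ n →
  sumBelow n f ≡ sumBelow m f + sumBelow (n ∸ m) (λ k → f (m + k))
sumBelow-split {m} {n} f m≤n =
  trans (cong (λ l → sumBelow l f) (sym (m+[n∸m]≡n m≤n))) (sumBelow-++ m (n ∸ m) f)

sumBelow-suc : ∀ n (f : ℕ → ℕ) → sumBelow (suc n) f ≡ sumBelow n f + f n
sumBelow-suc n f = begin
  sumBelow (suc n) f              ≡⟨ cong (λ l → sumBelow l f) (+-comm 1 n) ⟩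
  sumBelow (n + 1) f              ≡⟨ sumBelow-++ n 1 f ⟩
  sumBelow n f + (f (n + 0) + 0)  ≡⟨ cong (sumBelow n f +_) (trans (+-identityʳ _) (cong f (+-identityʳ n))) ⟩
  sumBelow n f + f n              ∎

sumBelow-mono-≤ : ∀ {m n} (f : ℕ → ℕ) → m ≤ n → sumBelow m f ≤ sumBelow n f
sumBelow-mono-≤ f m≤n = subst (_ ≤_) (sym (sumBelow-split f m≤n)) (m≤m+n _ _)

sumBelow-blocks : ∀ m d (f : ℕ → ℕ) →
  sumBelow m (λ i → sumBelow d (λ k → f (i * d + k))) ≡ sumBelow (m * d) f
sumBelow-blocks zero    d f = refl
sumBelow-blocks (suc m) d f = begin
  sumBelow d f + sumBelow m (λ i → sumBelow d (λ k → f (d + i * d + k)))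
    ≡⟨ cong (sumBelow d f +_) (sumBelow-cong m (λ i _ → sumBelow-cong d (λ k _ → cong f (+-assoc d (i * d) k)))) ⟩
  sumBelow d f + sumBelow m (λ i → sumBelow d (λ k → f (d + (i * d + k))))
    ≡⟨ cong (sumBelow d f +_) (sumBelow-blocks m d (λ k → f (d + k))) ⟩
  sumBelow d f + sumBelow (m * d) (λ k → f (d + k))
    ≡⟨ sumBelow-++ d (m * d) f ⟨
  sumBelow (d + m * d) f ∎

≡ᵇ-sym : ∀ m n → (m ≡ᵇ n) ≡ (n ≡ᵇ m)
≡ᵇ-sym zero    zero    = refl
≡ᵇ-sym zero    (suc n) = refl
≡ᵇ-sym (suc m) zero    = refl
≡ᵇ-sym (suc m) (suc n) = ≡ᵇ-sym m n

sumBelow-≡ᵇ : ∀ {n j} → j < n → sumBelow n (λ k → 𝟙 (k ≡ᵇ j)) ≡ 1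
sumBelow-≡ᵇ {suc n} {zero}  _         = cong suc (sumBelow-zero n (λ _ _ → refl))
sumBelow-≡ᵇ {suc n} {suc j} (s<s j<n) = sumBelow-≡ᵇ j<n

sumBelow-when : ∀ n b (f : ℕ → ℕ) {u} → (b ≡ true → sumBelow n f ≡ u) →
  sumBelow n (λ k → when b (f k)) ≡ when b u
sumBelow-when n true  f eq = eq refl
sumBelow-when n false f eq = sumBelow-zero n (λ _ _ → refl)

sumBelow-unless : ∀ n b (f : ℕ → ℕ) {u} → (b ≡ false → sumBelow n f ≡ u) →
  sumBelow n (λ k → unless b (f k)) ≡ unless b u
sumBelow-unless n true  f eq = sumBelow-zero n (λ _ _ → refl)
sumBelow-unless n false f eq = eq refl

sumBelow-when-< : ∀ {r n} (f : ℕ → ℕ) → r ≤ n → sumBelow n (λ k → when (k <ᵇ r) (f k)) ≡ sumBelow r f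
sumBelow-when-< {r} {n} f r≤n = begin
  sumBelow n (λ k → when (k <ᵇ r) (f k))
    ≡⟨ sumBelow-split g r≤n ⟩
  sumBelow r (λ k → when (k <ᵇ r) (f k)) + sumBelow (n ∸ r) (λ k → when (r + k <ᵇ r) (f (r + k)))
    ≡⟨ cong₂ _+_ (sumBelow-cong r (λ k k<r → cong (λ b → when b (f k)) (<⇒<ᵇ≡true k<r)))
                 (sumBelow-zero (n ∸ r) (λ k _ → cong (λ b → when b (f (r + k))) (≤⇒<ᵇ≡false (m≤m+n r k)))) ⟩
  sumBelow r f + 0
    ≡⟨ +-identityʳ _ ⟩
  sumBelow r f ∎
  where
  g : ℕ → ℕ
  g k = when (k <ᵇ r) (f k)

sumBelow-unless-< : ∀ {r n} (f : ℕ → ℕ) → r ≤ n →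
  sumBelow n (λ k → unless (k <ᵇ r) (f (k ∸ r))) ≡ sumBelow (n ∸ r) f
sumBelow-unless-< {r} {n} f r≤n = begin
  sumBelow n (λ k → unless (k <ᵇ r) (f (k ∸ r)))
    ≡⟨ sumBelow-split g r≤n ⟩
  sumBelow r (λ k → unless (k <ᵇ r) (f (k ∸ r))) + sumBelow (n ∸ r) (λ k → unless (r + k <ᵇ r) (f (r + k ∸ r)))
    ≡⟨ cong₂ _+_ (sumBelow-zero r (λ k k<r → cong (λ b → unless b (f (k ∸ r))) (<⇒<ᵇ≡true k<r)))
                 (sumBelow-cong (n ∸ r) (λ k _ → trans (cong (λ b → unless b (f (r + k ∸ r))) (≤⇒<ᵇ≡false (m≤m+n r k)))
                                                        (cong f (m+n∸m≡n r k)))) ⟩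
  sumBelow (n ∸ r) f ∎
  where
  g : ℕ → ℕ
  g k = unless (k <ᵇ r) (f (k ∸ r))

-- 0/1 matrices with constant row and column sums

module Cyclic (n : ℕ) {{_ : NonZero n}} where

  residue : ℕ → ℕ → ℕ
  residue j x = 𝟙 (x % n ≡ᵇ j)

  sumBelow-residue : ∀ {j} → j < n → ∀ s → sumBelow n (λ k → residue j (s + k)) ≡ 1
  sumBelow-residue {j} j<n zero = trans
    (sumBelow-cong n (λ k k<n → cong (λ x → 𝟙 (x ≡ᵇ j)) (m<n⇒m%n≡m k<n)))
    (sumBelow-≡ᵇ j<n)
  sumBelow-residue {j} j<n (suc s) = +-cancelˡ-≡ (residue j s) _ _ (begin
    residue j s + sumBelow n (λ k → residue j (suc s + k))
      ≡⟨ cong₂ _+_ (cong (residue j) (sym (+-identityʳ s)))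
                   (sumBelow-cong n (λ k _ → cong (residue j) (sym (+-suc s k)))) ⟩
    sumBelow (suc n) (λ k → residue j (s + k))
      ≡⟨ sumBelow-suc n (λ k → residue j (s + k)) ⟩
    sumBelow n (λ k → residue j (s + k)) + residue j (s + n)
      ≡⟨ cong₂ _+_ (sumBelow-residue j<n s) (cong (λ x → 𝟙 (x ≡ᵇ j)) ([m+n]%n≡m%n s n)) ⟩
    1 + residue j s
      ≡⟨ +-comm 1 _ ⟩
    residue j s + 1 ∎)

  -- Row i has ones in the columns i d, …, i d + d − 1 (mod n), so the first m rows cover m d
  -- consecutive integers; when m d = n e these hit every residue exactly e times.
  cyclic : ℕ → ℕ → ℕ → ℕ
  cyclic d i j = sumBelow d (λ k → residue j (i * d + k))

  cyclic≤1 : ∀ {d j} i → d ≤ n → j < n → cyclic d i j ≤ 1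
  cyclic≤1 {d} i d≤n j<n =
    ≤-trans (sumBelow-mono-≤ (λ k → residue _ (i * d + k)) d≤n) (≤-reflexive (sumBelow-residue j<n (i * d)))

  cyclic-rowSum : ∀ d i → sumBelow n (cyclic d i) ≡ d
  cyclic-rowSum d i = begin
    sumBelow n (λ j → sumBelow d (λ k → residue j (i * d + k)))
      ≡⟨ sumBelow-comm d n (λ k j → residue j (i * d + k)) ⟨
    sumBelow d (λ k → sumBelow n (λ j → residue j (i * d + k)))
      ≡⟨ sumBelow-cong d (λ k _ → hit (i * d + k)) ⟩
    sumBelow d (λ _ → 1)
      ≡⟨ sumBelow-const d 1 ⟩
    d * 1
      ≡⟨ *-identityʳ d ⟩
    d ∎
    where
    hit : ∀ x → sumBelow n (λ j → residue j x) ≡ 1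
    hit x = trans (sumBelow-cong n (λ j _ → cong 𝟙 (≡ᵇ-sym (x % n) j))) (sumBelow-≡ᵇ (m%n<n x n))

  cyclic-colSum : ∀ m d e → m * d ≡ n * e → ∀ {j} → j < n → sumBelow m (λ i → cyclic d i j) ≡ e
  cyclic-colSum m d e md≡ne {j} j<n = begin
    sumBelow m (λ i → sumBelow d (λ k → residue j (i * d + k)))
      ≡⟨ sumBelow-blocks m d (residue j) ⟩
    sumBelow (m * d) (residue j)
      ≡⟨ cong (λ l → sumBelow l (residue j)) (trans md≡ne (*-comm n e)) ⟩
    sumBelow (e * n) (residue j)
      ≡⟨ sumBelow-blocks e n (residue j) ⟨
    sumBelow e (λ i → sumBelow n (λ k → residue j (i * n + k)))
      ≡⟨ sumBelow-cong e (λ i _ → sumBelow-residue j<n (i * n)) ⟩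
    sumBelow e (λ _ → 1)
      ≡⟨ sumBelow-const e 1 ⟩
    e * 1
      ≡⟨ *-identityʳ e ⟩
    e ∎

  cyclic-0-0 : ∀ {d} → 0 < d → 1 ≤ cyclic d 0 0
  cyclic-0-0 {suc d} _ =
    ≤-trans (≤-reflexive (cong (λ x → 𝟙 (x ≡ᵇ 0)) (sym (m<n⇒m%n≡m n>0)))) (m≤m+n _ _)
    where
    n>0 : 0 < n
    n>0 = >-nonZero⁻¹ n

-- Neighbour counts in H(3,q)

-- `does` rather than ⌊_⌋ (as in `diff`): only then does same (suc x) (suc y) reduce to same x y.
same : ∀ {q} → Fin q → Fin q → ℕ
same x y = 𝟙 (does (x ≟ y))

same+diff : ∀ {q} (x y : Fin q) → same x y + diff x y ≡ 1
same+diff x y with x ≟ y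
... | yes _ = refl
... | no  _ = refl

∑-same : ∀ {q} (x : Fin q) (f : Fin q → ℕ) → ∑[ y < q ] (same x y * f y) ≡ f x
∑-same {suc q} zero    f = trans (cong₂ _+_ (+-identityʳ (f zero)) (sum-replicate-zero q)) (+-identityʳ (f zero))
∑-same {suc q} (suc x) f = ∑-same x (λ y → f (suc y))

∑-diff : ∀ {q} (x : Fin q) (f : Fin q → ℕ) → ∑[ y < q ] f y ≡ f x + ∑[ y < q ] (diff x y * f y)
∑-diff {q} x f = begin
  ∑[ y < q ] f y
    ≡⟨ sum-cong-≗ (λ y → begin
        f y                          ≡⟨ *-identityˡ (f y) ⟨
        1 * f y                      ≡⟨ cong (_* f y) (same+diff x y) ⟨
        (same x y + diff x y) * f y  ≡⟨ *-distribʳ-+ (f y) (same x y) (diff x y) ⟩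
        same x y * f y + diff x y * f y ∎) ⟩
  ∑[ y < q ] (same x y * f y + diff x y * f y)
    ≡⟨ ∑-distrib-+ (λ y → same x y * f y) (λ y → diff x y * f y) ⟩
  ∑[ y < q ] (same x y * f y) + ∑[ y < q ] (diff x y * f y)
    ≡⟨ cong (_+ ∑[ y < q ] (diff x y * f y)) (∑-same x f) ⟩
  f x + ∑[ y < q ] (diff x y * f y) ∎

∑-*ˡ : ∀ {n} k (f : Fin n → ℕ) → ∑[ i < n ] (k * f i) ≡ k * ∑[ i < n ] f i
∑-*ˡ k f = sym (*-distribˡ-sum k f)

∑-1 : ∀ n → ∑[ i < n ] 1 ≡ n
∑-1 zero    = refl
∑-1 (suc n) = cong suc (∑-1 n)

∑³ : ∀ {q} → (Fin q → Fin q → Fin q → ℕ) → ℕ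
∑³ {q} F = ∑[ a < q ] ∑[ b < q ] ∑[ c < q ] F a b c

∑³-cong : ∀ {q} {F G : Fin q → Fin q → Fin q → ℕ} → (∀ a b c → F a b c ≡ G a b c) → ∑³ F ≡ ∑³ G
∑³-cong F≗G = sum-cong-≗ λ a → sum-cong-≗ λ b → sum-cong-≗ λ c → F≗G a b c

∑³-distrib-+ : ∀ {q} (F G : Fin q → Fin q → Fin q → ℕ) → ∑³ (λ a b c → F a b c + G a b c) ≡ ∑³ F + ∑³ G
∑³-distrib-+ {q} F G = trans
  (sum-cong-≗ λ a → trans (sum-cong-≗ λ b → ∑-distrib-+ (F a b) (G a b))
                          (∑-distrib-+ (λ b → ∑[ c < q ] F a b c) (λ b → ∑[ c < q ] G a b c)))
  (∑-distrib-+ (λ a → ∑[ b < q ] ∑[ c < q ] F a b c) (λ a → ∑[ b < q ] ∑[ c < q ] G a b c))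

∑³-factor : ∀ {q} (f g h : Fin q → ℕ) (F : Fin q → Fin q → Fin q → ℕ) →
  ∑³ (λ a b c → f a * (g b * (h c * F a b c)))
    ≡ ∑[ a < q ] (f a * ∑[ b < q ] (g b * ∑[ c < q ] (h c * F a b c)))
∑³-factor {q} f g h F = sum-cong-≗ λ a → begin
  ∑[ b < q ] ∑[ c < q ] (f a * (g b * (h c * F a b c)))
    ≡⟨ sum-cong-≗ (λ b → trans (∑-*ˡ (f a) (λ c → g b * (h c * F a b c)))
                               (cong (f a *_) (∑-*ˡ (g b) (λ c → h c * F a b c)))) ⟩
  ∑[ b < q ] (f a * (g b * ∑[ c < q ] (h c * F a b c)))
    ≡⟨ ∑-*ˡ (f a) (λ b → g b * ∑[ c < q ] (h c * F a b c)) ⟩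
  f a * ∑[ b < q ] (g b * ∑[ c < q ] (h c * F a b c)) ∎

listSum-map-tabulate : ∀ {A : Set} {n} (h : A → ℕ) (f : Fin n → A) →
  listSum (map h (tabulate f)) ≡ ∑[ i < n ] h (f i)
listSum-map-tabulate {n = zero}  h f = refl
listSum-map-tabulate {n = suc n} h f = cong (h (f zero) +_) (listSum-map-tabulate h (λ i → f (suc i)))

listSum-map-concatMap : ∀ {A B : Set} (h : B → ℕ) (g : A → List B) (xs : List A) →
  listSum (map h (concatMap g xs)) ≡ listSum (map (λ x → listSum (map h (g x))) xs)
listSum-map-concatMap h g []       = refl
listSum-map-concatMap h g (x ∷ xs) = begin
  listSum (map h (g x ++ concatMap g xs))
    ≡⟨ cong listSum (map-++ h (g x) _) ⟩
  listSum (map h (g x) ++ map h (concatMap g xs))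
    ≡⟨ listSum-++ (map h (g x)) _ ⟩
  listSum (map h (g x)) + listSum (map h (concatMap g xs))
    ≡⟨ cong (listSum (map h (g x)) +_) (listSum-map-concatMap h g xs) ⟩
  listSum (map h (g x)) + listSum (map (λ x → listSum (map h (g x))) xs) ∎

count-∑³ : ∀ {q} (P : Vertex q → Bool) →
  count P ≡ ∑³ (λ x y z → 𝟙 (P (x , y , z)))
count-∑³ {q} P = begin
  listSum (map I (concatMap plane (allFin q)))
    ≡⟨ listSum-map-concatMap I plane (allFin q) ⟩
  listSum (map (λ x → listSum (map I (plane x))) (allFin q))
    ≡⟨ listSum-map-tabulate (λ x → listSum (map I (plane x))) id ⟩
  ∑[ x < q ] listSum (map I (plane x))
    ≡⟨ sum-cong-≗ (λ x → trans (listSum-map-concatMap I (line x) (allFin q))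
                                (listSum-map-tabulate (λ y → listSum (map I (line x y))) id)) ⟩
  ∑[ x < q ] ∑[ y < q ] listSum (map I (line x y))
    ≡⟨ sum-cong-≗ (λ x → sum-cong-≗ (λ y → trans (cong listSum (sym (map-∘ (allFin q))))
                                                 (listSum-map-tabulate (λ z → I (x , y , z)) id))) ⟩
  ∑[ x < q ] ∑[ y < q ] ∑[ z < q ] I (x , y , z) ∎
  where
  I : Vertex q → ℕ
  I v = 𝟙 (P v)
  line : Fin q → Fin q → List (Vertex q)
  line x y = map (λ z → (x , y , z)) (allFin q)
  plane : Fin q → List (Vertex q)
  plane x = concatMap (line x) (allFin q)

lineSum adjacentSum : ∀ {q} → (Vertex q → ℕ) → Vertex q → ℕ
lineSum {q} F (x , y , z) =
  ∑[ a < q ] F (a , y , z) + ∑[ b < q ] F (x , b , z) + ∑[ c < q ] F (x , y , c)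
adjacentSum {q} F (x , y , z) =
  ∑[ a < q ] (diff x a * F (a , y , z)) + ∑[ b < q ] (diff y b * F (x , b , z)) + ∑[ c < q ] (diff z c * F (x , y , c))

adjacent-∧-expand : ∀ {q} (x y z a b c : Fin q) e →
  𝟙 (adjacent? (x , y , z) (a , b , c) ∧ e)
    ≡ diff x a * (same y b * (same z c * 𝟙 e)) + same x a * (diff y b * (same z c * 𝟙 e))
      + same x a * (same y b * (diff z c * 𝟙 e))
adjacent-∧-expand x y z a b c e with x ≟ a | y ≟ b | z ≟ c | e
... | yes _ | yes _ | yes _ | true  = refl
... | yes _ | yes _ | yes _ | false = refl
... | yes _ | yes _ | no  _ | true  = refl
... | yes _ | yes _ | no  _ | false = refl
... | yes _ | no  _ | yes _ | true  = refl
... | yes _ | no  _ | yes _ | false = refl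
... | yes _ | no  _ | no  _ | true  = refl
... | yes _ | no  _ | no  _ | false = refl
... | no  _ | yes _ | yes _ | true  = refl
... | no  _ | yes _ | yes _ | false = refl
... | no  _ | yes _ | no  _ | true  = refl
... | no  _ | yes _ | no  _ | false = refl
... | no  _ | no  _ | yes _ | true  = refl
... | no  _ | no  _ | yes _ | false = refl
... | no  _ | no  _ | no  _ | true  = refl
... | no  _ | no  _ | no  _ | false = refl

count-adjacent : ∀ {q} (D : Vertex q → Bool) v →
  count (λ w → adjacent? v w ∧ D w) ≡ adjacentSum (𝟙 ∘ D) v
count-adjacent {q} D (x , y , z) = begin
  count (λ w → adjacent? (x , y , z) w ∧ D w)
    ≡⟨ count-∑³ (λ w → adjacent? (x , y , z) w ∧ D w) ⟩
  ∑³ (λ a b c → 𝟙 (adjacent? (x , y , z) (a , b , c) ∧ D (a , b , c)))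
    ≡⟨ ∑³-cong (λ a b c → adjacent-∧-expand x y z a b c (D (a , b , c))) ⟩
  ∑³ (λ a b c → T₁ a b c + T₂ a b c + T₃ a b c)
    ≡⟨ trans (∑³-distrib-+ (λ a b c → T₁ a b c + T₂ a b c) T₃) (cong (_+ ∑³ T₃) (∑³-distrib-+ T₁ T₂)) ⟩
  ∑³ T₁ + ∑³ T₂ + ∑³ T₃
    ≡⟨ cong₂ _+_ (cong₂ _+_ line₁ line₂) line₃ ⟩
  adjacentSum (𝟙 ∘ D) (x , y , z) ∎
  where
  I : Fin q → Fin q → Fin q → ℕ
  I a b c = 𝟙 (D (a , b , c))
  T₁ T₂ T₃ : Fin q → Fin q → Fin q → ℕ
  T₁ a b c = diff x a * (same y b * (same z c * I a b c))
  T₂ a b c = same x a * (diff y b * (same z c * I a b c))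
  T₃ a b c = same x a * (same y b * (diff z c * I a b c))
  line₁ : ∑³ T₁ ≡ ∑[ a < q ] (diff x a * I a y z)
  line₁ = trans (∑³-factor (diff x) (same y) (same z) I)
    (sum-cong-≗ λ a → cong (diff x a *_)
      (trans (sum-cong-≗ λ b → cong (same y b *_) (∑-same z (I a b))) (∑-same y (λ b → I a b z))))
  line₂ : ∑³ T₂ ≡ ∑[ b < q ] (diff y b * I x b z)
  line₂ = trans (∑³-factor (same x) (diff y) (same z) I)
    (trans (∑-same x (λ a → ∑[ b < q ] (diff y b * ∑[ c < q ] (same z c * I a b c))))
      (sum-cong-≗ λ b → cong (diff y b *_) (∑-same z (I x b))))
  line₃ : ∑³ T₃ ≡ ∑[ c < q ] (diff z c * I x y c)
  line₃ = trans (∑³-factor (same x) (same y) (diff z) I)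
    (trans (∑-same x (λ a → ∑[ b < q ] (same y b * ∑[ c < q ] (diff z c * I a b c))))
      (∑-same y (λ b → ∑[ c < q ] (diff z c * I x b c))))

lineSum-adjacentSum : ∀ {q} (F : Vertex q → ℕ) v → lineSum F v ≡ 3 * F v + adjacentSum F v
lineSum-adjacentSum F (x , y , z) = trans
  (cong₂ _+_ (cong₂ _+_ (∑-diff x (λ a → F (a , y , z))) (∑-diff y (λ b → F (x , b , z))))
             (∑-diff z (λ c → F (x , y , c))))
  (collect (F (x , y , z)) _ _ _)
  where
  collect : ∀ u X Y Z → u + X + (u + Y) + (u + Z) ≡ 3 * u + (X + Y + Z)
  collect = solve-∀

∑-diff-partition : ∀ {q} (x : Fin q) (D : Fin q → Bool) →
  ∑[ a < q ] (diff x a * 𝟙 (D a)) + ∑[ a < q ] (diff x a * 𝟙 (not (D a))) + 1 ≡ q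
∑-diff-partition {q} x D = begin
  ∑[ a < q ] (diff x a * 𝟙 (D a)) + ∑[ a < q ] (diff x a * 𝟙 (not (D a))) + 1
    ≡⟨ cong (_+ 1) (∑-distrib-+ (λ a → diff x a * 𝟙 (D a)) (λ a → diff x a * 𝟙 (not (D a)))) ⟨
  ∑[ a < q ] (diff x a * 𝟙 (D a) + diff x a * 𝟙 (not (D a))) + 1
    ≡⟨ cong (_+ 1) (sum-cong-≗ λ a → trans (sym (*-distribˡ-+ (diff x a) (𝟙 (D a)) _)) (cong (diff x a *_) (𝟙+𝟙-not (D a)))) ⟩
  ∑[ a < q ] (diff x a * 1) + 1
    ≡⟨ +-comm _ 1 ⟩
  1 + ∑[ a < q ] (diff x a * 1)
    ≡⟨ ∑-diff x (λ _ → 1) ⟨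
  ∑[ a < q ] 1
    ≡⟨ ∑-1 q ⟩
  q ∎
  where
  𝟙+𝟙-not : ∀ b → 𝟙 b + 𝟙 (not b) ≡ 1
  𝟙+𝟙-not true  = refl
  𝟙+𝟙-not false = refl

adjacentSum-partition : ∀ {q} (D : Vertex q → Bool) v →
  adjacentSum (𝟙 ∘ D) v + adjacentSum (𝟙 ∘ not ∘ D) v + 3 ≡ 3 * q
adjacentSum-partition {q} D (x , y , z) = trans
  (regroup (∑[ a < q ] (diff x a * 𝟙 (D (a , y , z)))) _ _ _ _ _)
  (trans (cong₂ _+_ (cong₂ _+_ (∑-diff-partition x (λ a → D (a , y , z))) (∑-diff-partition y (λ b → D (x , b , z))))
                    (∑-diff-partition z (λ c → D (x , y , c))))
         (thrice q))
  where
  regroup : ∀ X Y Z X′ Y′ Z′ → X + Y + Z + (X′ + Y′ + Z′) + 3 ≡ (X + X′ + 1) + (Y + Y′ + 1) + (Z + Z′ + 1)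
  regroup = solve-∀
  thrice : ∀ n → n + n + n ≡ 3 * n
  thrice = solve-∀

nbrsInside-lineSum : ∀ {q} (C : Code q) v → lineSum (𝟙 ∘ C) v ≡ 3 * 𝟙 (C v) + nbrsInside C v
nbrsInside-lineSum C v = trans (lineSum-adjacentSum (𝟙 ∘ C) v) (cong (3 * 𝟙 (C v) +_) (sym (count-adjacent C v)))

nbrsInside+nbrsOutside : ∀ {q} (C : Code q) v → nbrsInside C v + nbrsOutside C v + 3 ≡ 3 * q
nbrsInside+nbrsOutside C v =
  trans (cong₂ (λ m n → m + n + 3) (count-adjacent C v) (count-adjacent (not ∘ C) v)) (adjacentSum-partition C v)

lineSum⇒CRC1 : ∀ {q} (C : Code q) γ → (∀ v → lineSum (𝟙 ∘ C) v ≡ γ + q * 𝟙 (C v)) →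
  ∃[ v ] C v ≡ true → ∃[ v ] C v ≡ false → 1 ≤ γ → γ < 2 * q → CRC1 q C (2 * q ∸ γ) γ
lineSum⇒CRC1 {q} C γ lines nonempty proper 1≤γ γ<2q = record
  { nonempty = nonempty
  ; proper   = proper
  ; β-pos    = m<n⇒0<n∸m γ<2q
  ; γ-pos    = 1≤γ
  ; inside   = inside
  ; outside  = outside
  }
  where
  regular : ∀ v → 3 * 𝟙 (C v) + nbrsInside C v ≡ γ + q * 𝟙 (C v)
  regular v = trans (sym (nbrsInside-lineSum C v)) (lines v)

  outside : ∀ v → C v ≡ false → nbrsInside C v ≡ γ
  outside v Cv≡false = begin
    nbrsInside C v                       ≡⟨⟩
    3 * 0 + nbrsInside C v               ≡⟨ cong (λ b → 3 * 𝟙 b + nbrsInside C v) Cv≡false ⟨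
    3 * 𝟙 (C v) + nbrsInside C v         ≡⟨ regular v ⟩
    γ + q * 𝟙 (C v)                      ≡⟨ cong (λ b → γ + q * 𝟙 b) Cv≡false ⟩
    γ + q * 0                            ≡⟨ cong (γ +_) (*-zeroʳ q) ⟩
    γ + 0                                ≡⟨ +-identityʳ γ ⟩
    γ                                    ∎

  inside : ∀ v → C v ≡ true → nbrsOutside C v ≡ 2 * q ∸ γ
  inside v Cv≡true = trans (sym (m+n∸n≡m (nbrsOutside C v) γ)) (cong (_∸ γ) (+-cancelʳ-≡ q _ _ (begin
    nbrsOutside C v + γ + q                ≡⟨ +-assoc (nbrsOutside C v) γ q ⟩
    nbrsOutside C v + (γ + q)              ≡⟨ cong (nbrsOutside C v +_) in-count ⟨
    nbrsOutside C v + (3 + nbrsInside C v) ≡⟨ shuffle (nbrsOutside C v) (nbrsInside C v) ⟩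
    nbrsInside C v + nbrsOutside C v + 3   ≡⟨ nbrsInside+nbrsOutside C v ⟩
    q + 2 * q                              ≡⟨ +-comm q (2 * q) ⟩
    2 * q + q                              ∎)))
    where
    in-count : 3 + nbrsInside C v ≡ γ + q
    in-count = trans (subst (λ b → 3 * 𝟙 b + nbrsInside C v ≡ γ + q * 𝟙 b) Cv≡true (regular v))
                     (cong (γ +_) (*-identityʳ q))
    shuffle : ∀ m n → m + (3 + n) ≡ n + m + 3
    shuffle = solve-∀

crcEigenvalue≡λ₂ : ∀ {q} β γ → 2 ≤ q → β + γ ≡ 2 * q → crcEigenvalue q β γ ≡ λ₂ q
crcEigenvalue≡λ₂ {suc (suc p)} β γ (s≤s (s≤s z≤n)) β+γ≡2q = begin
  ℤ.+ (3 * suc p) ℤ.- ℤ.+ (β + γ)             ≡⟨ cong (λ n → ℤ.+ (3 * suc p) ℤ.- ℤ.+ n) β+γ≡2q ⟩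
  ℤ.+ (3 * suc p) ℤ.- ℤ.+ (2 * (2 + p))       ≡⟨ ℤ.m-n≡m⊖n (3 * suc p) (2 * (2 + p)) ⟩
  3 * suc p ℤ.⊖ 2 * (2 + p)                   ≡⟨ cong₂ ℤ._⊖_ (3q-3 p) (2q p) ⟩
  (1 + 2 * p) + (2 + p) ℤ.⊖ ((1 + 2 * p) + 3) ≡⟨ ℤ.+-cancelˡ-⊖ (1 + 2 * p) (2 + p) 3 ⟩
  (2 + p) ℤ.⊖ 3                               ≡⟨ ℤ.m-n≡m⊖n (2 + p) 3 ⟨
  λ₂ (2 + p)                                  ∎
  where
  3q-3 : ∀ p → 3 * suc p ≡ (1 + 2 * p) + (2 + p)
  3q-3 = solve-∀
  2q : ∀ p → 2 * (2 + p) ≡ (1 + 2 * p) + 3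
  2q = solve-∀

module Construction
  (q r s t a b c : ℕ) {{_ : NonZero (q ∸ t)}} {{_ : NonZero (q ∸ s)}} {{_ : NonZero s}}
  (r≤q : r ≤ q) (s≤q : s ≤ q) (t≤q : t ≤ q)
  (c≤q∸t : c ≤ q ∸ t) (c≤q∸s : c ≤ q ∸ s) (a≤s : a ≤ s)
  (cr≡a[q∸t] : c * r ≡ a * (q ∸ t)) (b[q∸s]≡c[q∸r] : b * (q ∸ s) ≡ c * (q ∸ r)) (at≡bs : a * t ≡ b * s)
  where

  q∸t q∸s : ℕ
  q∸t = q ∸ t
  q∸s = q ∸ s

  open Cyclic q∸t using () renaming (cyclic to M₁; cyclic≤1 to M₁≤1; cyclic-rowSum to M₁-rowSum; cyclic-colSum to M₁-colSum)
  open Cyclic q∸s using () renaming (cyclic to M₂; cyclic≤1 to M₂≤1; cyclic-rowSum to M₂-rowSum; cyclic-colSum to M₂-colSum)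
  open Cyclic s   using () renaming (cyclic to M₃; cyclic≤1 to M₃≤1; cyclic-rowSum to M₃-rowSum; cyclic-colSum to M₃-colSum)

  P W Q : ℕ → ℕ → ℕ
  P x y = when (x <ᵇ r) (when (y <ᵇ q∸t) (M₁ c x y))
  W x z = unless (x <ᵇ r) (when (z <ᵇ q∸s) (M₂ c (x ∸ r) z))
  Q y z = unless (y <ᵇ q∸t) (unless (z <ᵇ q∸s) (M₃ a (y ∸ q∸t) (z ∸ q∸s)))

  χ : ℕ → ℕ → ℕ → ℕ
  χ x y z = P x y + W x z + Q y z

  z∸q∸s<s : ∀ {z} → z < q → (z <ᵇ q∸s) ≡ false → z ∸ q∸s < s
  z∸q∸s<s {z} z<q z≮q∸s = +-cancelˡ-< q∸s (z ∸ q∸s) s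
    (subst₂ _<_ (sym (m+[n∸m]≡n (<ᵇ≡false⇒≥ {z} {q∸s} z≮q∸s))) (sym (m∸n+n≡m s≤q)) z<q)

  -- Disjoint supports: P needs x < r and y < q − t, W needs r ≤ x and z < q − s, Q needs the opposite.
  χ≤1 : ∀ x y z → z < q → χ x y z ≤ 1
  χ≤1 x y z z<q with x <ᵇ r | y <ᵇ q∸t in y<? | z <ᵇ q∸s in z<?
  ... | true  | true  | _     = ≤-trans (≤-reflexive (trans (+-assoc _ 0 0) (+-identityʳ _))) (M₁≤1 x c≤q∸t (<ᵇ≡true⇒< y<?))
  ... | true  | false | true  = z≤n
  ... | true  | false | false = M₃≤1 (y ∸ q∸t) a≤s (z∸q∸s<s z<q z<?)
  ... | false | true  | true  = ≤-trans (≤-reflexive (+-identityʳ _)) (M₂≤1 (x ∸ r) c≤q∸s (<ᵇ≡true⇒< z<?))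
  ... | false | true  | false = z≤n
  ... | false | false | true  = ≤-trans (≤-reflexive (+-identityʳ _)) (M₂≤1 (x ∸ r) c≤q∸s (<ᵇ≡true⇒< z<?))
  ... | false | false | false = M₃≤1 (y ∸ q∸t) a≤s (z∸q∸s<s z<q z<?)

  q∸t≤q : q∸t ≤ q
  q∸t≤q = m∸n≤m q t

  q∸s≤q : q∸s ≤ q
  q∸s≤q = m∸n≤m q s

  P-colSum : ∀ y → sumBelow q (λ x → P x y) ≡ when (y <ᵇ q∸t) a
  P-colSum y = trans (sumBelow-when-< (λ x → when (y <ᵇ q∸t) (M₁ c x y)) r≤q)
    (sumBelow-when r (y <ᵇ q∸t) (λ x → M₁ c x y) (λ y<? → M₁-colSum r c a rc≡[q∸t]a (<ᵇ≡true⇒< {y} {q∸t} y<?)))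
    where
    rc≡[q∸t]a : r * c ≡ q∸t * a
    rc≡[q∸t]a = trans (*-comm r c) (trans cr≡a[q∸t] (*-comm a q∸t))

  P-rowSum : ∀ x → sumBelow q (P x) ≡ when (x <ᵇ r) c
  P-rowSum x = sumBelow-when q (x <ᵇ r) (λ y → when (y <ᵇ q∸t) (M₁ c x y)) λ _ → trans (sumBelow-when-< (M₁ c x) q∸t≤q) (M₁-rowSum c x)

  W-colSum : ∀ z → sumBelow q (λ x → W x z) ≡ when (z <ᵇ q∸s) b
  W-colSum z = trans (sumBelow-unless-< (λ k → when (z <ᵇ q∸s) (M₂ c k z)) r≤q)
    (sumBelow-when (q ∸ r) (z <ᵇ q∸s) (λ k → M₂ c k z) (λ z<? → M₂-colSum (q ∸ r) c b [q∸r]c≡[q∸s]b (<ᵇ≡true⇒< {z} {q∸s} z<?)))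
    where
    [q∸r]c≡[q∸s]b : (q ∸ r) * c ≡ q∸s * b
    [q∸r]c≡[q∸s]b = trans (*-comm (q ∸ r) c) (trans (sym b[q∸s]≡c[q∸r]) (*-comm b q∸s))

  W-rowSum : ∀ x → sumBelow q (W x) ≡ unless (x <ᵇ r) c
  W-rowSum x = sumBelow-unless q (x <ᵇ r) (λ z → when (z <ᵇ q∸s) (M₂ c (x ∸ r) z)) λ _ → trans (sumBelow-when-< (M₂ c (x ∸ r)) q∸s≤q) (M₂-rowSum c (x ∸ r))

  Q-colSum : ∀ {z} → z < q → sumBelow q (λ y → Q y z) ≡ unless (z <ᵇ q∸s) b
  Q-colSum {z} z<q = trans (sumBelow-unless-< (λ k → unless (z <ᵇ q∸s) (M₃ a k (z ∸ q∸s))) q∸t≤q)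
    (sumBelow-unless (q ∸ q∸t) (z <ᵇ q∸s) (λ k → M₃ a k (z ∸ q∸s)) (λ z≮? → M₃-colSum (q ∸ q∸t) a b [q∸[q∸t]]a≡sb (z∸q∸s<s z<q z≮?)))
    where
    [q∸[q∸t]]a≡sb : (q ∸ q∸t) * a ≡ s * b
    [q∸[q∸t]]a≡sb = trans (cong (_* a) (m∸[m∸n]≡n t≤q)) (trans (*-comm t a) (trans at≡bs (*-comm b s)))

  Q-rowSum : ∀ y → sumBelow q (Q y) ≡ unless (y <ᵇ q∸t) a
  Q-rowSum y = sumBelow-unless q (y <ᵇ q∸t) (λ z → unless (z <ᵇ q∸s) (M₃ a (y ∸ q∸t) (z ∸ q∸s))) λ _ → begin
    sumBelow q (λ z → unless (z <ᵇ q∸s) (M₃ a (y ∸ q∸t) (z ∸ q∸s))) ≡⟨ sumBelow-unless-< (M₃ a (y ∸ q∸t)) q∸s≤q ⟩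
    sumBelow (q ∸ q∸s) (M₃ a (y ∸ q∸t))                             ≡⟨ cong (λ l → sumBelow l (M₃ a (y ∸ q∸t))) (m∸[m∸n]≡n s≤q) ⟩
    sumBelow s (M₃ a (y ∸ q∸t))                                     ≡⟨ M₃-rowSum a (y ∸ q∸t) ⟩
    a                                                               ∎

  χ-lineSum : ∀ x y z → z < q →
    sumBelow q (λ x′ → χ x′ y z) + sumBelow q (λ y′ → χ x y′ z) + sumBelow q (χ x y) ≡ a + b + c + q * χ x y z
  χ-lineSum x y z z<q = begin
    sumBelow q (λ x′ → χ x′ y z) + sumBelow q (λ y′ → χ x y′ z) + sumBelow q (χ x y)
      ≡⟨ cong₂ _+_ (cong₂ _+_ along-x along-y) along-z ⟩
    (when (y <ᵇ q∸t) a + when (z <ᵇ q∸s) b + q * Q y z) + (when (x <ᵇ r) c + q * W x z + unless (z <ᵇ q∸s) b)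
      + (q * P x y + unless (x <ᵇ r) c + unless (y <ᵇ q∸t) a)
      ≡⟨ regroup (when (y <ᵇ q∸t) a) (when (z <ᵇ q∸s) b) (when (x <ᵇ r) c)
                 (unless (y <ᵇ q∸t) a) (unless (z <ᵇ q∸s) b) (unless (x <ᵇ r) c) (P x y) (W x z) (Q y z) q ⟩
    (when (y <ᵇ q∸t) a + unless (y <ᵇ q∸t) a) + (when (z <ᵇ q∸s) b + unless (z <ᵇ q∸s) b)
      + (when (x <ᵇ r) c + unless (x <ᵇ r) c) + q * χ x y z
      ≡⟨ cong (_+ q * χ x y z) (cong₂ _+_ (cong₂ _+_ (when+unless (y <ᵇ q∸t) a) (when+unless (z <ᵇ q∸s) b)) (when+unless (x <ᵇ r) c)) ⟩
    a + b + c + q * χ x y z ∎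
    where
    regroup : ∀ a₁ b₁ c₁ a₂ b₂ c₂ p w k n →
      (a₁ + b₁ + n * k) + (c₁ + n * w + b₂) + (n * p + c₂ + a₂) ≡ (a₁ + a₂) + (b₁ + b₂) + (c₁ + c₂) + n * (p + w + k)
    regroup = solve-∀
    along-x : sumBelow q (λ x′ → χ x′ y z) ≡ when (y <ᵇ q∸t) a + when (z <ᵇ q∸s) b + q * Q y z
    along-x = trans (sumBelow-+ q (λ x′ → P x′ y + W x′ z) (λ _ → Q y z))
      (cong₂ _+_ (trans (sumBelow-+ q (λ x′ → P x′ y) (λ x′ → W x′ z)) (cong₂ _+_ (P-colSum y) (W-colSum z)))
                 (sumBelow-const q (Q y z)))
    along-y : sumBelow q (λ y′ → χ x y′ z) ≡ when (x <ᵇ r) c + q * W x z + unless (z <ᵇ q∸s) b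
    along-y = trans (sumBelow-+ q (λ y′ → P x y′ + W x z) (λ y′ → Q y′ z))
      (cong₂ _+_ (trans (sumBelow-+ q (P x) (λ _ → W x z)) (cong₂ _+_ (P-rowSum x) (sumBelow-const q (W x z))))
                 (Q-colSum z<q))
    along-z : sumBelow q (χ x y) ≡ q * P x y + unless (x <ᵇ r) c + unless (y <ᵇ q∸t) a
    along-z = trans (sumBelow-+ q (λ z′ → P x y + W x z′) (Q y))
      (cong₂ _+_ (trans (sumBelow-+ q (λ _ → P x y) (W x)) (cong₂ _+_ (sumBelow-const q (P x y)) (W-rowSum x)))
                 (Q-rowSum y))

  χ-origin : 0 < r → 0 < c → 1 ≤ χ 0 0 0
  χ-origin 0<r 0<c =
    ≤-trans (Cyclic.cyclic-0-0 q∸t 0<c) (≤-trans (≤-reflexive (sym P≡M₁)) (≤-trans (m≤m+n _ _) (m≤m+n _ _)))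
    where
    P≡M₁ : P 0 0 ≡ M₁ c 0 0
    P≡M₁ = cong₂ (λ e e′ → when e (when e′ (M₁ c 0 0))) (<⇒<ᵇ≡true 0<r) (<⇒<ᵇ≡true (>-nonZero⁻¹ q∸t))

  χ-0-q∸t-0 : 0 < r → χ 0 q∸t 0 ≡ 0
  χ-0-q∸t-0 0<r = cong₂ _+_ (cong₂ _+_ P≡0 W≡0) Q≡0
    where
    P≡0 : P 0 q∸t ≡ 0
    P≡0 = trans (cong (λ e → when (0 <ᵇ r) (when e (M₁ c 0 q∸t))) (≤⇒<ᵇ≡false (≤-refl {q∸t}))) (when-0 (0 <ᵇ r))
    W≡0 : W 0 0 ≡ 0
    W≡0 = cong (λ e → unless e (when (0 <ᵇ q∸s) (M₂ c (0 ∸ r) 0))) (<⇒<ᵇ≡true 0<r)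
    Q≡0 : Q q∸t 0 ≡ 0
    Q≡0 = trans (cong (λ e → unless e (unless (0 <ᵇ q∸s) (M₃ a (q∸t ∸ q∸t) (0 ∸ q∸s)))) (≤⇒<ᵇ≡false (≤-refl {q∸t})))
                (cong (λ e → unless e (M₃ a (q∸t ∸ q∸t) (0 ∸ q∸s))) (<⇒<ᵇ≡true (>-nonZero⁻¹ q∸s)))

  code : Code q
  code (x , y , z) = 0 <ᵇ χ (toℕ x) (toℕ y) (toℕ z)

  𝟙-code : ∀ x y z → 𝟙 (code (x , y , z)) ≡ χ (toℕ x) (toℕ y) (toℕ z)
  𝟙-code x y z = 𝟙-0<ᵇ (χ≤1 (toℕ x) (toℕ y) (toℕ z) (toℕ<n z))
    where
    𝟙-0<ᵇ : ∀ {n} → n ≤ 1 → 𝟙 (0 <ᵇ n) ≡ n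
    𝟙-0<ᵇ z≤n       = refl
    𝟙-0<ᵇ (s≤s z≤n) = refl

  code-lineSum : ∀ v → lineSum (𝟙 ∘ code) v ≡ a + b + c + q * 𝟙 (code v)
  code-lineSum (x , y , z) = begin
    lineSum (𝟙 ∘ code) (x , y , z)
      ≡⟨ cong₂ _+_ (cong₂ _+_ (sum-cong-≗ λ i → 𝟙-code i y z) (sum-cong-≗ λ j → 𝟙-code x j z)) (sum-cong-≗ λ k → 𝟙-code x y k) ⟩
    sumBelow q (λ i → χ i (toℕ y) (toℕ z)) + sumBelow q (λ j → χ (toℕ x) j (toℕ z)) + sumBelow q (χ (toℕ x) (toℕ y))
      ≡⟨ χ-lineSum (toℕ x) (toℕ y) (toℕ z) (toℕ<n z) ⟩
    a + b + c + q * χ (toℕ x) (toℕ y) (toℕ z)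
      ≡⟨ cong (λ n → a + b + c + q * n) (𝟙-code x y z) ⟨
    a + b + c + q * 𝟙 (code (x , y , z)) ∎

theorem3 : (q γ : ℕ) → 2 ≤ q → Condition1 q γ →
    ∃[ C ] Σ ℕ λ β → CRC1 q C β γ × crcEigenvalue q β γ ≡ λ₂ q
theorem3 q@(suc _) γ 2≤q
  (r , s , t , a , b , c , (0<r , r<q) , (0<s , s<q) , (0<t , t<q) ,
   (0<c , c≤q∸s⊓q∸t) , (0<b , b≤t⊓q∸r) , (0<a , a≤r⊓s) , cr≡a[q∸t] , b[q∸s]≡c[q∸r] , at≡bs , refl) =
  code , 2 * q ∸ (a + b + c) ,
  lineSum⇒CRC1 code (a + b + c) code-lineSum
    ((zero , zero , zero) , <⇒<ᵇ≡true (χ-origin 0<r 0<c))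
    ((zero , fromℕ< q∸t<q , zero) , cong (0 <ᵇ_) (trans (cong (λ y → χ 0 y 0) (toℕ-fromℕ< q∸t<q)) (χ-0-q∸t-0 0<r)))
    (≤-trans 0<a (≤-trans (m≤m+n a b) (m≤m+n (a + b) c)))
    γ<2q ,
  crcEigenvalue≡λ₂ (2 * q ∸ (a + b + c)) (a + b + c) 2≤q (m∸n+n≡m (<⇒≤ γ<2q))
  where
  instance
    _ : NonZero (q ∸ t)
    _ = >-nonZero (m<n⇒0<n∸m t<q)
    _ : NonZero (q ∸ s)
    _ = >-nonZero (m<n⇒0<n∸m s<q)
    _ : NonZero s
    _ = >-nonZero 0<s
  open Construction q r s t a b c (<⇒≤ r<q) (<⇒≤ s<q) (<⇒≤ t<q)
    (≤-trans c≤q∸s⊓q∸t (m⊓n≤n _ _)) (≤-trans c≤q∸s⊓q∸t (m⊓n≤m _ _)) (≤-trans a≤r⊓s (m⊓n≤n _ _))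
    cr≡a[q∸t] b[q∸s]≡c[q∸r] at≡bs
  q∸t<q : q ∸ t < q
  q∸t<q = ∸-monoʳ-< 0<t (<⇒≤ t<q)
  γ<2q : a + b + c < 2 * q
  γ<2q = subst (a + b + c <_) (cong (q +_) (sym (+-identityʳ q))) (+-mono-≤-< a+b≤q c<q)
    where
    a+b≤q : a + b ≤ q
    a+b≤q = ≤-trans (+-mono-≤ (≤-trans a≤r⊓s (m⊓n≤m _ _)) (≤-trans b≤t⊓q∸r (m⊓n≤n _ _))) (≤-reflexive (m+[n∸m]≡n (<⇒≤ r<q)))
    c<q : c < q
    c<q = ≤-<-trans (≤-trans c≤q∸s⊓q∸t (m⊓n≤m _ _)) (∸-monoʳ-< 0<s (<⇒≤ s<q))
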